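{- Let $n\geq 5$ and let $G$ be a nontrivial connected spanning convex subgraph of $C_n^2$. If $E(G)$ contains a frame, then $G=S_{n,k,j}$ for some integers $j,k$ with $0\leq j\leq n-1$ and $0\leq k\leq\lfloor\frac{n-2}{2}\rfloor$.
   Context: For $n\geq 5$, the square cycle $C_n^2$ has vertex set $\mathbb{Z}_n=\mathbb{Z}/n\mathbb{Z}$, with $v_i=i+n\mathbb{Z}$ for $i\in\mathbb{Z}$, and edge set $\{\{v_i,v_j\}: i-j\in\{1,2\}\}$. For $i\in\mathbb{Z}$ write $e_i=\{v_i,v_{i+1}\}$ (frames) and $f_i=\{v_i,v_{i+2}\}$ (windows), indices modulo $n$. A spanning subgraph has vertex set all of $\mathbb{Z}_n$. The triangles are $T_i=\{e_i,e_{i+1},f_i\}$; a subgraph $G$ is convex if for every $i$, either $|T_i\cap E(G)|\leq1$ or $T_i\subseteq E(G)$. The trivial connected spanning subgraphs are $C_n^2$ itself and, when $n$ is odd, the graph $(\mathbb{Z}_n,\{f_0,\dots,f_{n-1}\})$; "nontrivial" means not one of these. For integers $j,k$ with $0\leq k\leq\lceil\frac{n-2}{2}\rceil$, $S_{n,k,j}$ is the graph with vertex set $\mathbb{Z}_n$ and edge set $E(C_n^2)\setminus\big(\{f_j,f_{j+2k+1}\}\cup\{e_{j+1},\dots,e_{j+2k+1}\}\big)$. -}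

module Defs where

open import Data.Nat using (ℕ; zero; suc; _+_; _*_; _≤_; _<_; _≥_; _/_; NonZero; _≡ᵇ_)
open import Data.Nat.DivMod using (_mod_; _%_)

open import Data.Fin using (Fin; toℕ)
open import Data.Bool using (Bool; true; false; not; _∨_; if_then_else_)
open import Data.List using (List; upTo; map; foldr)
open import Data.Product using (Σ; _×_; _,_; ∃; ∃-syntax)
open import Data.Sum using (_⊎_)
open import Relation.Nullary using (¬_)
open import Relation.Binary.PropositionalEquality using (_≡_)
open import Relation.Binary.Construct.Closure.ReflexiveTransitive using (Star)

-- A spanning subgraph G of the square cycle C_n^2 (n ≥ 5) is determined by its
-- edge set, a subset of {e_0..e_{n-1}} ∪ {f_0..f_{n-1}} (all 2n edges are
-- distinct when n ≥ 5).  We record it by indicator functions: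
--   frame  i = true  iff  e_i = {v_i, v_{i+1}} ∈ E(G)
--   window i = true  iff  f_i = {v_i, v_{i+2}} ∈ E(G)
record SubC2 (n : ℕ) : Set where
  constructor sub
  field
    frame  : Fin n → Bool
    window : Fin n → Bool
open SubC2 public

-- index i ∈ ℤ reduced mod n (we only need i ≥ 0 since indices are taken mod n)
idx : (n : ℕ) → .{{NonZero n}} → ℕ → Fin n
idx n i = i mod n

v : (n : ℕ) → .{{NonZero n}} → ℕ → Fin n
v n i = idx n i

Adj : (n : ℕ) → .{{_ : NonZero n}} → SubC2 n → Fin n → Fin n → Set
Adj n G x y =
  Σ (Fin n) λ i →
    (frame G i ≡ true ×
      ((x ≡ i × y ≡ v n (toℕ i + 1)) ⊎ (y ≡ i × x ≡ v n (toℕ i + 1))))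
    ⊎
    (window G i ≡ true ×
      ((x ≡ i × y ≡ v n (toℕ i + 2)) ⊎ (y ≡ i × x ≡ v n (toℕ i + 2))))

Connected : (n : ℕ) → .{{_ : NonZero n}} → SubC2 n → Set
Connected n G = ∀ x y → Star (Adj n G) x y

bcount : Bool → ℕ
bcount true  = 1
bcount false = 0

triCount : (n : ℕ) → .{{_ : NonZero n}} → SubC2 n → Fin n → ℕ
triCount n G i =
  bcount (frame G i) + bcount (frame G (idx n (toℕ i + 1))) + bcount (window G i)

Convex : (n : ℕ) → .{{_ : NonZero n}} → SubC2 n → Set
Convex n G = ∀ (i : Fin n) → triCount n G i ≤ 1 ⊎ triCount n G i ≡ 3

_≐_ : {n : ℕ} → SubC2 n → SubC2 n → Set
G ≐ H = (∀ i → frame G i ≡ frame H i) × (∀ i → window G i ≡ window H i)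

full : (n : ℕ) → SubC2 n
full n = sub (λ _ → true) (λ _ → true)

windowsOnly : (n : ℕ) → SubC2 n
windowsOnly n = sub (λ _ → false) (λ _ → true)

Trivial : (n : ℕ) → SubC2 n → Set
Trivial n G = G ≐ full n ⊎ (n % 2 ≡ 1 × G ≐ windowsOnly n)

-- S_{n,k,j}: E(C_n^2) minus {f_j, f_{j+2k+1}} ∪ {e_{j+1},...,e_{j+2k+1}}
anyB : List Bool → Bool
anyB = foldr _∨_ false

removedFrame : (n : ℕ) → .{{_ : NonZero n}} → ℕ → ℕ → Fin n → Bool
removedFrame n k j i =
  anyB (map (λ s → toℕ i ≡ᵇ toℕ (idx n (j + suc s))) (upTo (suc (2 * k))))

removedWindow : (n : ℕ) → .{{_ : NonZero n}} → ℕ → ℕ → Fin n → Bool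
removedWindow n k j i =
  (toℕ i ≡ᵇ toℕ (idx n j)) ∨ (toℕ i ≡ᵇ toℕ (idx n (j + 2 * k + 1)))

S : (n : ℕ) → .{{_ : NonZero n}} → ℕ → ℕ → SubC2 n
S n k j = sub (λ i → not (removedFrame n k j i)) (λ i → not (removedWindow n k j i))

-- Choose p with e_p ∈ E(G) and e_{p+1} ∉ E(G), and look at G from v_p. The first run of missing
-- frames e_{p+1}, …, e_{p+L} has odd length L = 2k + 1 and contains every window f_{p+1}, …,
-- f_{p+L-1}: otherwise a set of alternate vertices of the run, bounded by missing windows, would
-- be cut off from v_p. A second run of missing frames is impossible, since the even vertices of
-- the first run, the frames between the runs and half of the second run would form a component
-- avoiding v_p. So all remaining frames are present, convexity supplies the windows between them and
-- forbids f_p and f_{p+L}, and G = S_{n,k,p}.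

module Submission where

open import Defs
open import Data.Bool using (Bool; true; false; not; T; _∨_) renaming (_≟_ to _≟ᵇ_)
open import Data.Bool.Properties using (T-≡; ¬-not; ∨-zeroʳ)
open import Data.Empty using (⊥; ⊥-elim)
open import Data.Fin using (Fin; toℕ)
open import Data.Fin.Properties using (toℕ-injective; toℕ-fromℕ<; toℕ<n)
open import Data.List using (upTo)
open import Data.List.Membership.Propositional using (find; lose)
open import Data.List.Membership.Propositional.Properties using (∈-upTo⁺; ∈-upTo⁻)
open import Data.List.Relation.Unary.Any.Properties using (any⁺; any⁻)
open import Data.Nat using (ℕ; zero; suc; pred; _+_; _*_; _∸_; _/_; _%_; _≤_; _<_; _≤?_; _<?_; _≟_;
  z≤n; s≤s; NonZero; >-nonZero⁻¹; _≡ᵇ_)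
open import Data.Nat.DivMod
open import Data.Nat.Properties
open import Algebra.Properties.CommutativeSemigroup +-commutativeSemigroup using (x∙yz≈y∙xz)
open import Data.Nat.Tactic.RingSolver using (solve-∀)
open import Data.Product using (_×_; _,_; ∃-syntax; proj₁; proj₂)
open import Data.Sum using (_⊎_; inj₁; inj₂; [_,_]′)
open import Function using (_∘_)
open import Function.Bundles using (Equivalence)
open import Relation.Binary.Construct.Closure.ReflexiveTransitive using (Star; ε; _◅_)
open import Relation.Binary.PropositionalEquality
open import Relation.Nullary using (¬_; yes; no)

-- Arithmetic modulo n

module _ {n : ℕ} {{_ : NonZero n}} where
  open ≡-Reasoning

  toℕ-mod : ∀ m → toℕ (m mod n) ≡ m % n
  toℕ-mod m = toℕ-fromℕ< _

  toℕ[i]-mod : ∀ (i : Fin n) → toℕ i mod n ≡ i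
  toℕ[i]-mod i = toℕ-injective (trans (toℕ-mod (toℕ i)) (m<n⇒m%n≡m (toℕ<n i)))

  %≡⇒mod≡ : ∀ {a b} → a % n ≡ b % n → a mod n ≡ b mod n
  %≡⇒mod≡ {a} {b} e = toℕ-injective (trans (toℕ-mod a) (trans e (sym (toℕ-mod b))))

  [m%n+k]%n≡[m+k]%n : ∀ m k → (m % n + k) % n ≡ (m + k) % n
  [m%n+k]%n≡[m+k]%n m k = begin
    (m % n + k) % n         ≡⟨ %-distribˡ-+ (m % n) k n ⟩
    (m % n % n + k % n) % n ≡⟨ cong (λ x → (x + k % n) % n) (m%n%n≡m%n m n) ⟩
    (m % n + k % n) % n     ≡⟨ %-distribˡ-+ m k n ⟨
    (m + k) % n             ∎

  [m+k%n]%n≡[m+k]%n : ∀ m k → (m + k % n) % n ≡ (m + k) % n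
  [m+k%n]%n≡[m+k]%n m k = begin
    (m + k % n) % n ≡⟨ cong (_% n) (+-comm m (k % n)) ⟩
    (k % n + m) % n ≡⟨ [m%n+k]%n≡[m+k]%n k m ⟩
    (k + m) % n     ≡⟨ cong (_% n) (+-comm k m) ⟩
    (m + k) % n     ∎

  [m+[n∸m%n]]%n≡0 : ∀ m → (m + (n ∸ m % n)) % n ≡ 0
  [m+[n∸m%n]]%n≡0 m = begin
    (m + (n ∸ m % n)) % n     ≡⟨ [m%n+k]%n≡[m+k]%n m _ ⟨
    (m % n + (n ∸ m % n)) % n ≡⟨ cong (_% n) (m+[n∸m]≡n (<⇒≤ (m%n<n m n))) ⟩
    n % n                     ≡⟨ n%n≡0 n ⟩
    0                         ∎

  [k+[m+[n∸m%n]]]%n≡k%n : ∀ m k → (k + (m + (n ∸ m % n))) % n ≡ k % n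
  [k+[m+[n∸m%n]]]%n≡k%n m k = begin
    (k + (m + (n ∸ m % n))) % n     ≡⟨ [m+k%n]%n≡[m+k]%n k _ ⟨
    (k + (m + (n ∸ m % n)) % n) % n ≡⟨ cong (λ x → (k + x) % n) ([m+[n∸m%n]]%n≡0 m) ⟩
    (k + 0) % n                     ≡⟨ cong (_% n) (+-identityʳ k) ⟩
    k % n                           ∎

  [x+y]+z≡y+[x+z] : ∀ x y z → x + y + z ≡ y + (x + z)
  [x+y]+z≡y+[x+z] x y z = trans (+-assoc x y z) (x∙yz≈y∙xz x y z)

  -- The t < n with x = v_{p+t}.
  offset : ℕ → Fin n → ℕ
  offset p x = (toℕ x + (n ∸ p % n)) % n

  offset<n : ∀ p x → offset p x < n
  offset<n p x = m%n<n _ n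

  rotate-offset : ∀ p x → (p + offset p x) mod n ≡ x
  rotate-offset p x = trans (%≡⇒mod≡ shifted) (toℕ[i]-mod x)
    where
    shifted : (p + offset p x) % n ≡ toℕ x % n
    shifted = begin
      (p + (toℕ x + (n ∸ p % n)) % n) % n ≡⟨ [m+k%n]%n≡[m+k]%n p _ ⟩
      (p + (toℕ x + (n ∸ p % n))) % n     ≡⟨ cong (_% n) (x∙yz≈y∙xz p (toℕ x) _) ⟩
      (toℕ x + (p + (n ∸ p % n))) % n     ≡⟨ [k+[m+[n∸m%n]]]%n≡k%n p (toℕ x) ⟩
      toℕ x % n                           ∎

  [[m+t]%n+[n∸m%n]]%n≡t%n : ∀ p t → ((p + t) % n + (n ∸ p % n)) % n ≡ t % n
  [[m+t]%n+[n∸m%n]]%n≡t%n p t = begin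
    ((p + t) % n + (n ∸ p % n)) % n ≡⟨ [m%n+k]%n≡[m+k]%n (p + t) _ ⟩
    (p + t + (n ∸ p % n)) % n       ≡⟨ cong (_% n) ([x+y]+z≡y+[x+z] p t _) ⟩
    (t + (p + (n ∸ p % n))) % n     ≡⟨ [k+[m+[n∸m%n]]]%n≡k%n p t ⟩
    t % n                           ∎

  offset-rotate : ∀ p {t} → t < n → offset p ((p + t) mod n) ≡ t
  offset-rotate p {t} t<n = begin
    (toℕ ((p + t) mod n) + (n ∸ p % n)) % n ≡⟨ cong (λ x → (x + (n ∸ p % n)) % n) (toℕ-mod _) ⟩
    ((p + t) % n + (n ∸ p % n)) % n         ≡⟨ [[m+t]%n+[n∸m%n]]%n≡t%n p t ⟩
    t % n                                   ≡⟨ m<n⇒m%n≡m t<n ⟩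
    t                                       ∎

  rotate-injective : ∀ p {a b} → a < n → b < n → (p + a) % n ≡ (p + b) % n → a ≡ b
  rotate-injective p {a} {b} a<n b<n e = begin
    a                               ≡⟨ m<n⇒m%n≡m a<n ⟨
    a % n                           ≡⟨ [[m+t]%n+[n∸m%n]]%n≡t%n p a ⟨
    ((p + a) % n + (n ∸ p % n)) % n ≡⟨ cong (λ x → (x + (n ∸ p % n)) % n) e ⟩
    ((p + b) % n + (n ∸ p % n)) % n ≡⟨ [[m+t]%n+[n∸m%n]]%n≡t%n p b ⟩
    b % n                           ≡⟨ m<n⇒m%n≡m b<n ⟩
    b                               ∎

  offset-step : ∀ p x s → offset p ((toℕ x + s) mod n) ≡ (s + offset p x) % n
  offset-step p x s = begin
    (toℕ ((toℕ x + s) mod n) + (n ∸ p % n)) % n ≡⟨ cong (λ y → (y + (n ∸ p % n)) % n) (toℕ-mod _) ⟩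
    ((toℕ x + s) % n + (n ∸ p % n)) % n         ≡⟨ [m%n+k]%n≡[m+k]%n (toℕ x + s) _ ⟩
    (toℕ x + s + (n ∸ p % n)) % n               ≡⟨ cong (_% n) ([x+y]+z≡y+[x+z] (toℕ x) s _) ⟩
    (s + (toℕ x + (n ∸ p % n))) % n             ≡⟨ [m+k%n]%n≡[m+k]%n s _ ⟨
    (s + offset p x) % n                        ∎

  wrapped-small : ∀ {t s} .{{_ : NonZero s}} → t < n → n ≤ s + t → (s + t) % n < s
  wrapped-small {t} {s} t<n n≤s+t =
    ≤-<-trans (≤-trans (≤-reflexive (sym (m≤n⇒[n∸m]%m≡n%m n≤s+t))) (m%n≤m (s + t ∸ n) n))
              (m<n+o⇒m∸n<o (s + t) n (subst (s + t <_) (+-comm s n) (+-monoʳ-< s t<n)))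

parity : ∀ t → ∃[ m ] (t ≡ 2 * m ⊎ t ≡ 1 + 2 * m)
parity zero = 0 , inj₁ refl
parity (suc t) with parity t
... | m , inj₁ refl = m , inj₂ refl
... | m , inj₂ refl = suc m , inj₁ (cong suc (sym (+-suc m (m + 0))))

2+[m+2n]≡m+2[1+n] : ∀ m n → 2 + (m + 2 * n) ≡ m + 2 * suc n
2+[m+2n]≡m+2[1+n] = solve-∀

a+[1+2[1+m+d]]≡a+[1+2m]+2[1+d] : ∀ a m d → a + (1 + 2 * suc (m + d)) ≡ a + (1 + 2 * m) + 2 * suc d
a+[1+2[1+m+d]]≡a+[1+2m]+2[1+d] = solve-∀

record Chain (a d u : ℕ) : Set where
  constructor chain
  field
    index    : ℕ
    index≤d  : index ≤ d
    position : u ≡ a + 2 * index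

chain-start : ∀ a d → Chain a d a
chain-start a d = chain 0 z≤n (sym (+-identityʳ a))

chain-end : ∀ a d → Chain a d (a + 2 * d)
chain-end a d = chain d ≤-refl refl

chain-bounds : ∀ {a d u} → Chain a d u → a ≤ u × u ≤ a + 2 * d
chain-bounds {a} (chain i i≤d refl) = m≤m+n a (2 * i) , +-monoʳ-≤ a (*-monoʳ-≤ 2 i≤d)

chain-up : ∀ {a d u} → Chain a d u → u ≢ a + 2 * d → Chain a d (2 + u)
chain-up {a} (chain i i≤d refl) u≢end =
  chain (suc i) (≤∧≢⇒< i≤d (λ { refl → u≢end refl })) (2+[m+2n]≡m+2[1+n] a i)

chain-down : ∀ {a d u} → Chain a d (2 + u) → 2 + u ≢ a → Chain a d u
chain-down {a} (chain zero _ e) 2+u≢a = ⊥-elim (2+u≢a (trans e (+-identityʳ a)))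
chain-down {a} (chain (suc i) i<d e) _ =
  chain i (<⇒≤ i<d) (+-cancelˡ-≡ 2 _ _ (trans e (sym (2+[m+2n]≡m+2[1+n] a i))))

first-change : (g : ℕ → Bool) (b : Bool) (d : ℕ) →
  (∀ t → t ≤ d → g t ≡ b) ⊎ ∃[ s ] (s ≤ d × g s ≡ not b × (∀ t → t < s → g t ≡ b))
first-change g b d with g 0 ≟ᵇ b
... | no g0≢b = inj₂ (0 , z≤n , ¬-not g0≢b , λ _ ())
first-change g b zero | yes g0≡b = inj₁ λ { zero _ → g0≡b }
first-change g b (suc d) | yes g0≡b with first-change (g ∘ suc) b d
... | inj₁ all = inj₁ λ { zero _ → g0≡b ; (suc t) t≤d → all t (≤-pred t≤d) }
... | inj₂ (s , s≤d , gs , before) =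
  inj₂ (suc s , s≤s s≤d , gs , λ { zero _ → g0≡b ; (suc t) t<s → before t (≤-pred t<s) })

ConvexTriangle : Bool → Bool → Bool → Set
ConvexTriangle a b c = bcount a + bcount b + bcount c ≤ 1 ⊎ bcount a + bcount b + bcount c ≡ 3

convex-tt : ∀ {a b c} → ConvexTriangle a b c → a ≡ true → b ≡ true → c ≡ true
convex-tt {c = true} _ _ _ = refl
convex-tt {c = false} (inj₁ (s≤s ())) refl refl
convex-tt {c = false} (inj₂ ()) refl refl

convex-tf : ∀ {a b c} → ConvexTriangle a b c → a ≡ true → b ≡ false → c ≡ false
convex-tf {c = false} _ _ _ = refl
convex-tf {c = true} (inj₁ (s≤s ())) refl refl
convex-tf {c = true} (inj₂ ()) refl refl

convex-ft : ∀ {a b c} → ConvexTriangle a b c → a ≡ false → b ≡ true → c ≡ false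
convex-ft {c = false} _ _ _ = refl
convex-ft {c = true} (inj₁ (s≤s ())) refl refl
convex-ft {c = true} (inj₂ ()) refl refl

≡⇒≡ᵇ-true : ∀ {m n} → m ≡ n → (m ≡ᵇ n) ≡ true
≡⇒≡ᵇ-true {m} {n} e = Equivalence.to T-≡ (≡⇒≡ᵇ m n e)

≢⇒≡ᵇ-false : ∀ {m n} → m ≢ n → (m ≡ᵇ n) ≡ false
≢⇒≡ᵇ-false {m} {n} m≢n = ¬-not (λ e → m≢n (≡ᵇ⇒≡ m n (Equivalence.from T-≡ e)))

-- The graphs S_{n,k,j}

module _ {n : ℕ} {{_ : NonZero n}} where
  open ≡-Reasoning

  ≐-from-offsets : ∀ {H H′ : SubC2 n} p →
    (∀ {t} → t < n → frame H ((p + t) mod n) ≡ frame H′ ((p + t) mod n)) →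
    (∀ {t} → t < n → window H ((p + t) mod n) ≡ window H′ ((p + t) mod n)) →
    H ≐ H′
  ≐-from-offsets {H} {H′} p frames windows =
    (λ i → subst (λ x → frame H x ≡ frame H′ x) (rotate-offset p i) (frames (offset<n p i))) ,
    (λ i → subst (λ x → window H x ≡ window H′ x) (rotate-offset p i) (windows (offset<n p i)))

  module _ (p k : ℕ) where

    toℕ-idx-shift : ∀ s → toℕ (idx n (p % n + s)) ≡ (p + s) % n
    toℕ-idx-shift s = trans (toℕ-mod (p % n + s)) ([m%n+k]%n≡[m+k]%n p s)

    toℕ-idx-start : toℕ (idx n (p % n)) ≡ (p + 0) % n
    toℕ-idx-start = trans (cong (toℕ ∘ idx n) (sym (+-identityʳ (p % n)))) (toℕ-idx-shift 0)

    toℕ-idx-end : toℕ (idx n (p % n + 2 * k + 1)) ≡ (p + (1 + 2 * k)) % n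
    toℕ-idx-end = begin
      toℕ (idx n (p % n + 2 * k + 1))   ≡⟨ cong (toℕ ∘ idx n) (trans (+-assoc (p % n) (2 * k) 1)
                                                                (cong (p % n +_) (+-comm (2 * k) 1))) ⟩
      toℕ (idx n (p % n + (1 + 2 * k))) ≡⟨ toℕ-idx-shift (1 + 2 * k) ⟩
      (p + (1 + 2 * k)) % n             ∎

    S-frame-removed : ∀ {t} → 0 < t → t ≤ 1 + 2 * k → frame (S n k (p % n)) ((p + t) mod n) ≡ false
    S-frame-removed {suc s} _ t≤L = cong not (Equivalence.to T-≡ (any⁺ _ (lose (∈-upTo⁺ t≤L) hit)))
      where
      hit : T (toℕ ((p + suc s) mod n) ≡ᵇ toℕ (idx n (p % n + suc s)))
      hit = ≡⇒≡ᵇ _ _ (trans (toℕ-mod (p + suc s)) (sym (toℕ-idx-shift (suc s))))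

    S-frame-kept : ∀ {t} → t < n → 1 + 2 * k < n → (t ≡ 0 ⊎ 1 + 2 * k < t) →
                   frame (S n k (p % n)) ((p + t) mod n) ≡ true
    S-frame-kept {t} t<n L<n outside = cong not (¬-not (λ e → miss (Equivalence.from T-≡ e)))
      where
      miss : ¬ T (removedFrame n k (p % n) ((p + t) mod n))
      miss hit with find (any⁻ _ (upTo (1 + 2 * k)) hit)
      ... | s , s∈ , eq with rotate-injective p t<n (≤-<-trans (∈-upTo⁻ s∈) L<n)
                               (trans (sym (toℕ-mod (p + t)))
                                 (trans (≡ᵇ⇒≡ _ _ eq) (toℕ-idx-shift (suc s))))
      ... | refl = [ (λ ()) , (λ L<t → <⇒≱ L<t (∈-upTo⁻ s∈)) ]′ outside

    S-window-removed : ∀ {t} → t ≡ 0 ⊎ t ≡ 1 + 2 * k →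
                       window (S n k (p % n)) ((p + t) mod n) ≡ false
    S-window-removed {t} (inj₁ refl) =
      cong (λ b → not (b ∨ (toℕ ((p + t) mod n) ≡ᵇ toℕ (idx n (p % n + 2 * k + 1)))))
           (≡⇒≡ᵇ-true (trans (toℕ-mod (p + 0)) (sym toℕ-idx-start)))
    S-window-removed {t} (inj₂ refl) =
      trans (cong (λ b → not ((toℕ ((p + t) mod n) ≡ᵇ toℕ (idx n (p % n))) ∨ b))
                  (≡⇒≡ᵇ-true (trans (toℕ-mod (p + t)) (sym toℕ-idx-end))))
            (cong not (∨-zeroʳ _))

    S-window-kept : ∀ {t} → t < n → 1 + 2 * k < n → t ≢ 0 → t ≢ 1 + 2 * k →
                    window (S n k (p % n)) ((p + t) mod n) ≡ true
    S-window-kept {t} t<n L<n t≢0 t≢L =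
      cong₂ (λ b c → not (b ∨ c))
        (≢⇒≡ᵇ-false {toℕ ((p + t) mod n)} (λ e → t≢0 (differs e toℕ-idx-start (≤-<-trans z≤n t<n))))
        (≢⇒≡ᵇ-false {toℕ ((p + t) mod n)} (λ e → t≢L (differs e toℕ-idx-end L<n)))
      where
      differs : ∀ {x b} → toℕ ((p + t) mod n) ≡ x → x ≡ (p + b) % n → b < n → t ≡ b
      differs e e′ b<n = rotate-injective p t<n b<n (trans (sym (toℕ-mod (p + t))) (trans e e′))

true≢false : ∀ {b} → b ≡ true → b ≢ false
true≢false refl ()

1+2k<n⇒k≤[n∸2]/2 : ∀ {n k} → 1 + 2 * k < n → k ≤ (n ∸ 2) / 2
1+2k<n⇒k≤[n∸2]/2 {suc (suc n)} {k} (s≤s (s≤s 2k≤n)) =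
  subst (_≤ n / 2) (trans (cong (_/ 2) (*-comm 2 k)) (m*n/n≡m k 2)) (/-monoˡ-≤ 2 2k≤n)

-- Spanning subgraphs of the square cycle

module _ {n : ℕ} {{_ : NonZero n}} (G : SubC2 n) where

  frameAt : ℕ → Bool
  frameAt u = frame G (u mod n)

  windowAt : ℕ → Bool
  windowAt u = window G (u mod n)

  triangle : Convex n G → ∀ u → ConvexTriangle (frameAt u) (frameAt (suc u)) (windowAt u)
  triangle convex u =
    subst (λ i → ConvexTriangle (frameAt u) (frame G i) (windowAt u)) next (convex (u mod n))
    where
    next : idx n (toℕ (u mod n) + 1) ≡ suc u mod n
    next = %≡⇒mod≡ (trans (cong (λ x → (x + 1) % n) (toℕ-mod u))
                   (trans ([m%n+k]%n≡[m+k]%n u 1) (cong (_% n) (+-comm u 1))))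

  frame-drop : Convex n G → ¬ Trivial n G → ∀ i₀ → frame G i₀ ≡ true →
               ∃[ p ] (frameAt p ≡ true × frameAt (suc p) ≡ false)
  frame-drop convex nontrivial i₀ fi₀ with first-change (λ t → frameAt (toℕ i₀ + t)) true (pred n)
  ... | inj₁ all = ⊥-elim (nontrivial (inj₁ (all-frames , all-windows)))
    where
    all-frames : ∀ i → frame G i ≡ true
    all-frames i = subst (λ x → frame G x ≡ true) (rotate-offset (toℕ i₀) i)
                         (all _ (<⇒≤pred (offset<n (toℕ i₀) i)))
    all-windows : ∀ i → window G i ≡ true
    all-windows i = subst (λ x → window G x ≡ true) (toℕ[i]-mod i)
                          (convex-tt (triangle convex (toℕ i)) (all-frames _) (all-frames _))
  ... | inj₂ (zero , _ , f₀ , _) =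
    ⊥-elim (true≢false fi₀ (trans (cong (frame G) (sym (toℕ[i]-mod i₀)))
                                  (subst (λ u → frameAt u ≡ false) (+-identityʳ _) f₀)))
  ... | inj₂ (suc s , _ , fs , before) =
    toℕ i₀ + s , before s ≤-refl , subst (λ u → frameAt u ≡ false) (+-suc (toℕ i₀) s) fs

  module FromVertex (p : ℕ) where

    F : ℕ → Bool
    F t = frameAt (p + t)

    W : ℕ → Bool
    W t = windowAt (p + t)

    F-period : F n ≡ F 0
    F-period = cong (frame G) (%≡⇒mod≡ (trans ([m+n]%n≡m%n p n) (cong (_% n) (sym (+-identityʳ p)))))

    -- A set of offsets closed under the edges of G. Offsets below 2 are excluded so that edges
    -- wrapping around past v_{p+n-1} need no separate treatment.
    record Separated (R : ℕ → Set) : Set where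
      field
        2≤ : ∀ {t} → R t → 2 ≤ t
        <n : ∀ {t} → R t → t < n
        frame-up    : ∀ {t} → F t ≡ true → R t → R (suc t)
        frame-down  : ∀ {t} → F t ≡ true → R (suc t) → R t
        window-up   : ∀ {t} → W t ≡ true → R t → R (2 + t)
        window-down : ∀ {t} → W t ≡ true → R (2 + t) → R t

    separated-empty : Connected n G → ∀ {R} → Separated R → ∀ {t} → ¬ R t
    separated-empty connected {R} sep {t} r = 2≰0 (2≤ at-base)
      where
      open Separated sep
      2≰0 : ¬ 2 ≤ 0
      2≰0 ()
      reduce : ∀ {u} → R u → R (u % n)
      reduce r = subst R (sym (m<n⇒m%n≡m (<n r))) r
      unwrap : ∀ {s u} .{{_ : NonZero s}} → s ≤ 2 → u < n → R ((s + u) % n) → R (s + u)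
      unwrap {s} {u} s≤2 u<n r with s + u <? n
      ... | yes s+u<n = subst R (m<n⇒m%n≡m s+u<n) r
      ... | no s+u≮n = ⊥-elim (<⇒≱ (wrapped-small u<n (≮⇒≥ s+u≮n)) (≤-trans s≤2 (2≤ r)))
      F-offset : ∀ i → F (offset p i) ≡ frame G i
      F-offset i = cong (frame G) (rotate-offset p i)
      W-offset : ∀ i → W (offset p i) ≡ window G i
      W-offset i = cong (window G) (rotate-offset p i)
      step : ∀ {x y} → Adj n G x y → R (offset p x) → R (offset p y)
      step (i , inj₁ (fi , inj₁ (refl , refl))) r =
        subst R (sym (offset-step p i 1)) (reduce (frame-up (trans (F-offset i) fi) r))
      step (i , inj₁ (fi , inj₂ (refl , refl))) r =
        frame-down (trans (F-offset i) fi) (unwrap (s≤s z≤n) (offset<n p i) (subst R (offset-step p i 1) r))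
      step (i , inj₂ (wi , inj₁ (refl , refl))) r =
        subst R (sym (offset-step p i 2)) (reduce (window-up (trans (W-offset i) wi) r))
      step (i , inj₂ (wi , inj₂ (refl , refl))) r =
        window-down (trans (W-offset i) wi) (unwrap ≤-refl (offset<n p i) (subst R (offset-step p i 2) r))
      walk : ∀ {x y} → Star (Adj n G) x y → R (offset p x) → R (offset p y)
      walk ε r = r
      walk (e ◅ es) r = walk es (step e r)
      at-base : R 0
      at-base = subst R (offset-rotate p (>-nonZero⁻¹ n))
                  (walk (connected ((p + t) mod n) ((p + 0) mod n)) (subst R (sym (offset-rotate p (<n r))) r))

    module _ (connected : Connected n G) (convex : Convex n G) where

      triangle-at : ∀ t → ConvexTriangle (F t) (F (suc t)) (W t)
      triangle-at t =
        subst (λ u → ConvexTriangle (F t) (frameAt u) (W t)) (sym (+-suc p t)) (triangle convex (p + t))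

      record Gap (a L : ℕ) : Set where
        field
          nonempty : 0 < L
          before   : F a ≡ true
          missing  : ∀ {t} → a < t → t ≤ a + L → F t ≡ false
          after    : F (suc (a + L)) ≡ true

      module _ {a L : ℕ} (A : Gap a L) where
        open Gap A

        gap-window-start : W a ≡ false
        gap-window-start = convex-tf (triangle-at a) before (missing ≤-refl (m<m+n a nonempty))

        gap-window-end : W (a + L) ≡ false
        gap-window-end = convex-ft (triangle-at (a + L)) (missing (m<m+n a nonempty) ≤-refl) after

      -- The vertices v_{p+a+2}, v_{p+a+4}, …, v_{p+a+2d+2} would otherwise be cut off from v_p.
      isolated-chain : ∀ a d → a + 2 * suc d < n →
        (∀ {t} → a < t → t ≤ a + 2 * suc d → F t ≡ false) →
        W a ≡ false → W (a + 2 * suc d) ≡ false → ⊥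
      isolated-chain a d end<n missing Wa Wend = separated-empty connected separated (chain-start (2 + a) d)
        where
        end : 2 + a + 2 * d ≡ a + 2 * suc d
        end = 2+[m+2n]≡m+2[1+n] a d
        range : ∀ {u} → Chain (2 + a) d u → 2 + a ≤ u × u ≤ a + 2 * suc d
        range {u} c = proj₁ (chain-bounds c) , subst (u ≤_) end (proj₂ (chain-bounds c))
        separated : Separated (Chain (2 + a) d)
        separated = record
          { 2≤ = λ c → ≤-trans (m≤m+n 2 a) (proj₁ (range c))
          ; <n = λ c → ≤-<-trans (proj₂ (range c)) end<n
          ; frame-up = λ Fu c → ⊥-elim (true≢false Fu
              (missing (≤-trans (n≤1+n _) (proj₁ (range c))) (proj₂ (range c))))
          ; frame-down = λ Fu c → ⊥-elim (true≢false Fu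
              (missing (≤-pred (proj₁ (range c))) (≤-trans (n≤1+n _) (proj₂ (range c)))))
          ; window-up = λ Wu c → chain-up c (λ u≡end → true≢false Wu
              (subst (λ x → W x ≡ false) (sym (trans u≡end end)) Wend))
          ; window-down = λ Wu c → chain-down c (λ 2+u≡2+a → true≢false Wu
              (subst (λ x → W x ≡ false) (sym (+-cancelˡ-≡ 2 _ _ 2+u≡2+a)) Wa))
          }

      gap-odd : ∀ {a L} → Gap a L → a + L < n → ∃[ k ] L ≡ 1 + 2 * k
      gap-odd {a} {L} A a+L<n with parity L
      ... | k , inj₂ L-odd = k , L-odd
      ... | zero , inj₁ refl = ⊥-elim (<-irrefl refl (Gap.nonempty A))
      ... | suc d , inj₁ refl =
        ⊥-elim (isolated-chain a d a+L<n (Gap.missing A) (gap-window-start A) (gap-window-end A))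

      gap-windows : ∀ {a L} → Gap a L → a + L < n → ∀ {t} → 0 < t → t < L → W (a + t) ≡ true
      gap-windows {a} {L} A a+L<n {t} 0<t t<L with W (a + t) in Wt
      ... | true = refl
      ... | false with parity t | gap-odd A a+L<n
      ...   | zero , inj₁ refl | _ = ⊥-elim (<-irrefl refl 0<t)
      ...   | suc d , inj₁ refl | _ = ⊥-elim (
        isolated-chain a d (<-trans (+-monoʳ-< a t<L) a+L<n)
          (λ a<u u≤ → Gap.missing A a<u (≤-trans u≤ (+-monoʳ-≤ a (<⇒≤ t<L))))
          (gap-window-start A) Wt)
      ...   | m , inj₂ refl | k , refl
        with d , refl ← m≤n⇒∃[o]m+o≡n (*-cancelˡ-< 2 m k (≤-pred t<L)) = ⊥-elim (
        isolated-chain (a + t) d (subst (_< n) split a+L<n)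
          (λ {u} a+t<u u≤ →
            Gap.missing A (≤-<-trans (m≤m+n a t) a+t<u) (subst (u ≤_) (sym split) u≤))
          Wt (subst (λ x → W x ≡ false) split (gap-window-end A)))
        where
        split : a + (1 + 2 * suc (m + d)) ≡ a + (1 + 2 * m) + 2 * suc d
        split = a+[1+2[1+m+d]]≡a+[1+2m]+2[1+d] a m d

      -- The even vertices of the first gap, the run of frames between the gaps and the vertices
      -- of the second gap of the same parity as its start form a component that misses v_p.
      module TwoGaps {a k b k₂} (A : Gap a (1 + 2 * k)) (B : Gap b (1 + 2 * k₂))
                     (a+L<b : a + (1 + 2 * k) < b) (b+L₂<n : b + (1 + 2 * k₂) < n) where

        L L₂ : ℕ
        L = 1 + 2 * k
        L₂ = 1 + 2 * k₂

        Component : ℕ → Set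
        Component u = Chain (2 + a) k u ⊎ (a + L < u × u ≤ suc b) ⊎ Chain (suc b) k₂ u

        left-end : 2 + a + 2 * k ≡ suc (a + L)
        left-end = cong suc (sym (+-suc a (2 * k)))

        right-end : suc b + 2 * k₂ ≡ b + L₂
        right-end = sym (+-suc b (2 * k₂))

        a<a+L : a < a + L
        a<a+L = m<m+n a (s≤s z≤n)

        b<b+L₂ : b < b + L₂
        b<b+L₂ = m<m+n b (s≤s z≤n)

        range : ∀ {u} → Component u → 2 + a ≤ u × u ≤ b + L₂
        range {u} (inj₁ c) =
          proj₁ (chain-bounds c) ,
          ≤-trans (subst (u ≤_) left-end (proj₂ (chain-bounds c))) (≤-trans a+L<b (<⇒≤ b<b+L₂))
        range (inj₂ (inj₁ (lo , hi))) = ≤-trans (s≤s a<a+L) lo , ≤-trans hi b<b+L₂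
        range {u} (inj₂ (inj₂ c)) =
          ≤-trans (s≤s a<a+L) (≤-trans a+L<b (≤-trans (n≤1+n b) (proj₁ (chain-bounds c)))) ,
          subst (u ≤_) right-end (proj₂ (chain-bounds c))

        between-gaps : ∀ {u} → F u ≡ true → a < u → u ≤ b + L₂ → a + L < u × u ≤ b
        between-gaps {u} Fu a<u u≤b+L₂ with u ≤? a + L | u ≤? b
        ... | yes u≤a+L | _ = ⊥-elim (true≢false Fu (Gap.missing A a<u u≤a+L))
        ... | no u≰a+L | yes u≤b = ≰⇒> u≰a+L , u≤b
        ... | no _ | no u≰b = ⊥-elim (true≢false Fu (Gap.missing B (≰⇒> u≰b) u≤b+L₂))

        no-window : ∀ {u v} → W u ≡ true → W v ≡ false → u ≢ v
        no-window Wu Wv refl = true≢false Wu Wv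

        right-up : ∀ {u} → W u ≡ true → Chain (suc b) k₂ u → Component (2 + u)
        right-up Wu c =
          inj₂ (inj₂ (chain-up c (λ u≡end → no-window Wu (gap-window-end B) (trans u≡end right-end))))

        block-up : ∀ {u} → W u ≡ true → a + L < u → u ≤ suc b → Component (2 + u)
        block-up {u} Wu lo hi with 2 + u ≤? suc b | m≤n⇒m<n∨m≡n hi
        ... | yes 2+u≤1+b | _ = inj₂ (inj₁ (≤-trans lo (m≤n+m u 2) , 2+u≤1+b))
        ... | no _ | inj₂ refl = right-up Wu (chain-start (suc b) k₂)
        ... | no 2+u≰1+b | inj₁ u<1+b =
          ⊥-elim (no-window Wu (gap-window-start B)
                   (≤-antisym (≤-pred u<1+b) (≤-pred (≤-pred (≰⇒> 2+u≰1+b)))))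

        left-up : ∀ {u} → W u ≡ true → Chain (2 + a) k u → Component (2 + u)
        left-up {u} Wu c with u ≟ 2 + a + 2 * k
        ... | no u≢end = inj₁ (chain-up c u≢end)
        ... | yes refl =
          block-up Wu (≤-reflexive (sym left-end)) (≤-trans (≤-reflexive left-end) (≤-trans a+L<b (n≤1+n b)))

        left-down : ∀ {u} → W u ≡ true → Chain (2 + a) k (2 + u) → Component u
        left-down Wu c =
          inj₁ (chain-down c (λ 2+u≡2+a → no-window Wu (gap-window-start A) (+-cancelˡ-≡ 2 _ _ 2+u≡2+a)))

        block-down : ∀ {u} → W u ≡ true → a + L < 2 + u → 2 + u ≤ suc b → Component u
        block-down {u} Wu lo hi with a + L <? u | m≤n⇒m<n∨m≡n (≤-pred lo)
        ... | yes a+L<u | _ = inj₂ (inj₁ (a+L<u , ≤-trans (m≤n+m u 2) hi))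
        ... | no _ | inj₂ a+L≡1+u = left-down Wu (subst (Chain (2 + a) k) 2+u≡end (chain-end (2 + a) k))
          where
          2+u≡end : 2 + a + 2 * k ≡ 2 + u
          2+u≡end = trans left-end (cong suc a+L≡1+u)
        ... | no a+L≮u | inj₁ a+L<1+u =
          ⊥-elim (no-window Wu (gap-window-end A) (≤-antisym (≮⇒≥ a+L≮u) (≤-pred a+L<1+u)))

        right-down : ∀ {u} → W u ≡ true → Chain (suc b) k₂ (2 + u) → Component u
        right-down {u} Wu c with 2 + u ≟ suc b
        ... | no 2+u≢1+b = inj₂ (inj₂ (chain-down c 2+u≢1+b))
        ... | yes 2+u≡1+b =
          block-down Wu (subst (a + L <_) (sym 2+u≡1+b) (≤-trans a+L<b (n≤1+n b))) (≤-reflexive 2+u≡1+b)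

        separated : Separated Component
        separated = record
          { 2≤ = λ c → ≤-trans (m≤m+n 2 a) (proj₁ (range c))
          ; <n = λ c → ≤-<-trans (proj₂ (range c)) b+L₂<n
          ; frame-up = λ Fu c →
              let lo , hi = between-gaps Fu (≤-trans (n≤1+n _) (proj₁ (range c))) (proj₂ (range c))
              in inj₂ (inj₁ (≤-trans lo (n≤1+n _) , s≤s hi))
          ; frame-down = λ Fu c →
              let lo , hi = between-gaps Fu (≤-pred (proj₁ (range c)))
                                            (≤-trans (n≤1+n _) (proj₂ (range c)))
              in inj₂ (inj₁ (lo , ≤-trans hi (n≤1+n b)))
          ; window-up = λ where
              Wu (inj₁ c) → left-up Wu c
              Wu (inj₂ (inj₁ (lo , hi))) → block-up Wu lo hi
              Wu (inj₂ (inj₂ c)) → right-up Wu c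
          ; window-down = λ where
              Wu (inj₁ c) → left-down Wu c
              Wu (inj₂ (inj₁ (lo , hi))) → block-down Wu lo hi
              Wu (inj₂ (inj₂ c)) → right-down Wu c
          }

      no-second-gap : ∀ {a L b L₂} → Gap a L → Gap b L₂ → a + L < b → b + L₂ < n → ⊥
      no-second-gap {a} {L} {b} {L₂} A B a+L<b b+L₂<n
        with gap-odd A (<-trans a+L<b (≤-<-trans (m≤m+n b L₂) b+L₂<n)) | gap-odd B b+L₂<n
      ... | k , refl | k₂ , refl =
        separated-empty connected (TwoGaps.separated {k = k} {k₂ = k₂} A B a+L<b b+L₂<n)
          (inj₂ (inj₁ (≤-refl , ≤-trans a+L<b (n≤1+n b))))

      gap-after : ∀ {a b} → F a ≡ true → F (suc a) ≡ false → a < b → F b ≡ true →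
                  ∃[ L ] (Gap a L × a + L < b)
      gap-after {a} {b} Fa F1+a a<b Fb with first-change (λ j → F (suc (a + j))) false (b ∸ suc a)
      ... | inj₁ all =
        ⊥-elim (true≢false Fb (subst (λ u → F u ≡ false) (m+[n∸m]≡n a<b) (all _ ≤-refl)))
      ... | inj₂ (zero , _ , F1+a+0 , _) =
        ⊥-elim (true≢false (subst (λ u → F (suc u) ≡ true) (+-identityʳ a) F1+a+0) F1+a)
      ... | inj₂ (suc l , 1+l≤ , after , before) =
        suc l , record { nonempty = s≤s z≤n ; before = Fa ; missing = missing ; after = after } , a+L<b
        where
        missing : ∀ {t} → a < t → t ≤ a + suc l → F t ≡ false
        missing a<t t≤ with j , refl ← m≤n⇒∃[o]m+o≡n a<t =
          before j (s≤s (+-cancelˡ-≤ a j l (≤-pred (subst (suc (a + j) ≤_) (+-suc a l) t≤))))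
        a+L<b : a + suc l < b
        a+L<b = subst (suc (a + suc l) ≤_) (m+[n∸m]≡n a<b) (+-monoʳ-≤ (suc a) 1+l≤)

      frames-after-gap : ∀ {L} → Gap 0 L → L < n → ∀ {t} → L < t → t ≤ n → F t ≡ true
      frames-after-gap {L} A L<n {t} L<t t≤n with first-change (λ j → F (suc (L + j))) true (n ∸ suc L)
      ... | inj₁ all with j , refl ← m≤n⇒∃[o]m+o≡n L<t =
        all j (+-cancelˡ-≤ (suc L) j _ (subst (suc (L + j) ≤_) (sym (m+[n∸m]≡n L<n)) t≤n))
      ... | inj₂ (zero , _ , F1+L+0 , _) =
        ⊥-elim (true≢false (Gap.after A) (subst (λ u → F (suc u) ≡ false) (+-identityʳ L) F1+L+0))
      ... | inj₂ (suc s , 1+s≤ , F2+L+s , before)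
        with L₂ , B , q+L₂<n ← gap-after {a = suc (L + s)} (before s ≤-refl)
                                 (subst (λ u → F (suc u) ≡ false) (+-suc L s) F2+L+s)
                                 (subst (_≤ n) (+-suc (suc L) s)
                                   (subst (suc L + suc s ≤_) (m+[n∸m]≡n L<n) (+-monoʳ-≤ (suc L) 1+s≤)))
                                 (trans F-period (Gap.before A)) =
        ⊥-elim (no-second-gap A B (s≤s (m≤m+n L s)) q+L₂<n)

      single-gap⇒≐S : ∀ {k} → Gap 0 (1 + 2 * k) → 1 + 2 * k < n →
                      (∀ {t} → 1 + 2 * k < t → t ≤ n → F t ≡ true) → G ≐ S n k (p % n)
      single-gap⇒≐S {k} A L<n rest = ≐-from-offsets p frames windows
        where
        L : ℕ
        L = 1 + 2 * k
        frames : ∀ {t} → t < n → F t ≡ frame (S n k (p % n)) ((p + t) mod n)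
        frames {zero} 0<n = trans (Gap.before A) (sym (S-frame-kept p k 0<n L<n (inj₁ refl)))
        frames {suc t} 1+t<n with suc t ≤? L
        ... | yes 1+t≤L =
          trans (Gap.missing A (s≤s z≤n) 1+t≤L) (sym (S-frame-removed p k (s≤s z≤n) 1+t≤L))
        ... | no 1+t≰L =
          trans (rest (≰⇒> 1+t≰L) (<⇒≤ 1+t<n)) (sym (S-frame-kept p k 1+t<n L<n (inj₂ (≰⇒> 1+t≰L))))
        W-present : ∀ {t} → t < n → t ≢ 0 → t ≢ L → W t ≡ true
        W-present {t} t<n t≢0 t≢L with t <? L
        ... | yes t<L = gap-windows A L<n (n≢0⇒n>0 t≢0) t<L
        ... | no t≮L =
          convex-tt (triangle-at t) (rest L<t (<⇒≤ t<n)) (rest (≤-trans L<t (n≤1+n t)) t<n)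
          where
          L<t : L < t
          L<t = ≤∧≢⇒< (≮⇒≥ t≮L) (≢-sym t≢L)
        windows : ∀ {t} → t < n → W t ≡ window (S n k (p % n)) ((p + t) mod n)
        windows {t} t<n with t ≟ 0 | t ≟ L
        ... | yes refl | _ = trans (gap-window-start A) (sym (S-window-removed p k (inj₁ refl)))
        ... | no _ | yes refl = trans (gap-window-end A) (sym (S-window-removed p k (inj₂ refl)))
        ... | no t≢0 | no t≢L =
          trans (W-present t<n t≢0 t≢L) (sym (S-window-kept p k t<n L<n t≢0 t≢L))

      frame-drop⇒≐S : frameAt p ≡ true → frameAt (suc p) ≡ false →
                      ∃[ k ] (1 + 2 * k < n × G ≐ S n k (p % n))
      frame-drop⇒≐S Fp F1+p with gap-after F0 F1 (>-nonZero⁻¹ n) (trans F-period F0)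
        where
        F0 : F 0 ≡ true
        F0 = subst (λ u → frameAt u ≡ true) (sym (+-identityʳ p)) Fp
        F1 : F 1 ≡ false
        F1 = subst (λ u → frameAt u ≡ false) (+-comm 1 p) F1+p
      ... | L , A , L<n with gap-odd A L<n
      ... | k , refl = k , L<n , single-gap⇒≐S {k} A L<n (frames-after-gap A L<n)

lemma3p3 : (m : ℕ) → (G : SubC2 (suc (suc (suc (suc (suc m)))))) →
    let n = suc (suc (suc (suc (suc m)))) in
    ¬ Trivial n G → Connected n G → Convex n G →
    (∃[ i ] frame G i ≡ true) →
    ∃[ j ] ∃[ k ] (j ≤ n ∸ 1 × k ≤ (n ∸ 2) / 2 × G ≐ S n k j)
lemma3p3 m G nontrivial connected convex (i₀ , fi₀)
  with p , Fp , F1+p ← frame-drop G convex nontrivial i₀ fi₀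
  with k , 1+2k<n , G≐S ← FromVertex.frame-drop⇒≐S G p connected convex Fp F1+p =
  p % _ , k , ≤-pred (m%n<n p _) , 1+2k<n⇒k≤[n∸2]/2 1+2k<n , G≐S
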